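{- Let $d\ge 1$ and let $W$ be a set of $w$ edges of the complete tripartite graph $K_{d,d,d}$. Then $W$ contains at least $d\cdot\max(w-2d^2,0)$ triangles (triangles of $K_{d,d,d}$ all three of whose edges lie in $W$). The bound is tight: for every $0\le w\le 3d^2$ there is a set of $w$ edges containing exactly $d\cdot\max(w-2d^2,0)$ triangles. -}

module Defs where

open import Data.Nat using (ℕ; zero; suc; _+_)
open import Data.Fin using (Fin; zero; suc)
open import Data.Bool using (Bool; true; false; _∧_)

sumFin : (n : ℕ) → (Fin n → ℕ) → ℕ
sumFin zero    f = 0
sumFin (suc n) f = f zero + sumFin n (λ i → f (suc i))

𝟙 : Bool → ℕ
𝟙 true  = 1
𝟙 false = 0

-- The complete tripartite graph K_{d,d,d} has parts A, B, C, each a copy of Fin d.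
-- Its edge set is the disjoint union of A×B, B×C and C×A.  A set W of edges
-- of K_{d,d,d} is thus given by its three characteristic functions.
record EdgeSet (d : ℕ) : Set where
  field
    AB : Fin d → Fin d → Bool
    BC : Fin d → Fin d → Bool
    CA : Fin d → Fin d → Bool
open EdgeSet public

edgeCount : {d : ℕ} → EdgeSet d → ℕ
edgeCount {d} W =
    sumFin d (λ a → sumFin d (λ b → 𝟙 (AB W a b)))
  + sumFin d (λ b → sumFin d (λ c → 𝟙 (BC W b c)))
  + sumFin d (λ c → sumFin d (λ a → 𝟙 (CA W c a)))

triangleCount : {d : ℕ} → EdgeSet d → ℕ
triangleCount {d} W =
  sumFin d (λ a → sumFin d (λ b → sumFin d (λ c →
    𝟙 (AB W a b ∧ BC W b c ∧ CA W c a))))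

module Submission where

-- For each of the d³ triples (a, b, c) with a ∈ A, b ∈ B, c ∈ C, at most two of the edges
-- ab, bc, ca lie in W unless abc is a triangle of W.  Summing this over all triples counts
-- every edge of W exactly d times, so d·|W| ≤ 2d³ + #triangles.  For tightness, put the w
-- edges into A×B first, then B×C, then C×A: every triangle uses a C×A edge and each such
-- edge lies in d triples, so there are at most d·(w − 2d²) triangles, and the lower bound
-- forces equality.

open import Defs
open import Data.Nat using (ℕ; _*_; _∸_; _≤_)
open import Data.Product using (_×_; Σ-syntax)
open import Relation.Binary.PropositionalEquality using (_≡_)

open import Data.Bool using (Bool; true; false; _∧_)
open import Data.Fin using (Fin; zero; suc; toℕ)
open import Data.Nat using (zero; suc; _+_; _⊓_; _<ᵇ_; z≤n; s≤s)
open import Data.Nat.Properties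
open import Algebra.Properties.CommutativeSemigroup +-commutativeSemigroup using (interchange)
open import Data.Product using (_,_)
open import Relation.Binary.PropositionalEquality
  using (refl; sym; trans; cong; cong₂; subst; module ≡-Reasoning)

sumFin-cong : ∀ n {f g : Fin n → ℕ} → (∀ i → f i ≡ g i) → sumFin n f ≡ sumFin n g
sumFin-cong zero    f≗g = refl
sumFin-cong (suc n) f≗g = cong₂ _+_ (f≗g zero) (sumFin-cong n (λ i → f≗g (suc i)))

sumFin-mono-≤ : ∀ n {f g : Fin n → ℕ} → (∀ i → f i ≤ g i) → sumFin n f ≤ sumFin n g
sumFin-mono-≤ zero    f≤g = z≤n
sumFin-mono-≤ (suc n) f≤g = +-mono-≤ (f≤g zero) (sumFin-mono-≤ n (λ i → f≤g (suc i)))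

sumFin-+ : ∀ n (f g : Fin n → ℕ) → sumFin n (λ i → f i + g i) ≡ sumFin n f + sumFin n g
sumFin-+ zero    f g = refl
sumFin-+ (suc n) f g =
  trans (cong (f zero + g zero +_) (sumFin-+ n (λ i → f (suc i)) (λ i → g (suc i))))
        (interchange (f zero) (g zero) _ _)

sumFin-*ˡ : ∀ n k (f : Fin n → ℕ) → sumFin n (λ i → k * f i) ≡ k * sumFin n f
sumFin-*ˡ zero    k f = sym (*-zeroʳ k)
sumFin-*ˡ (suc n) k f =
  trans (cong (k * f zero +_) (sumFin-*ˡ n k (λ i → f (suc i)))) (sym (*-distribˡ-+ k (f zero) _))

sumFin-const : ∀ n k → sumFin n (λ _ → k) ≡ n * k
sumFin-const zero    k = refl
sumFin-const (suc n) k = cong (k +_) (sumFin-const n k)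

sumFin-swap : ∀ m n (f : Fin m → Fin n → ℕ) →
  sumFin m (λ i → sumFin n (f i)) ≡ sumFin n (λ j → sumFin m (λ i → f i j))
sumFin-swap zero    n f = sym (trans (sumFin-const n 0) (*-zeroʳ n))
sumFin-swap (suc m) n f =
  trans (cong (sumFin n (f zero) +_) (sumFin-swap m n (λ i → f (suc i))))
        (sym (sumFin-+ n (f zero) (λ j → sumFin m (λ i → f (suc i) j))))

sumFin² : ∀ d → (Fin d → Fin d → ℕ) → ℕ
sumFin² d f = sumFin d (λ x → sumFin d (f x))

sumFin³ : ∀ d → (Fin d → Fin d → Fin d → ℕ) → ℕ
sumFin³ d f = sumFin d (λ x → sumFin² d (f x))

sumFin³-+ : ∀ d (f g : Fin d → Fin d → Fin d → ℕ) →
  sumFin³ d (λ a b c → f a b c + g a b c) ≡ sumFin³ d f + sumFin³ d g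
sumFin³-+ d f g =
  trans (sumFin-cong d (λ a → trans (sumFin-cong d (λ b → sumFin-+ d (f a b) (g a b)))
                                    (sumFin-+ d _ _)))
        (sumFin-+ d _ _)

sumFin³-mono-≤ : ∀ d {f g : Fin d → Fin d → Fin d → ℕ} →
  (∀ a b c → f a b c ≤ g a b c) → sumFin³ d f ≤ sumFin³ d g
sumFin³-mono-≤ d f≤g = sumFin-mono-≤ d (λ a → sumFin-mono-≤ d (λ b → sumFin-mono-≤ d (f≤g a b)))

sumFin³-const₃ : ∀ d (g : Fin d → Fin d → ℕ) → sumFin³ d (λ a b _ → g a b) ≡ d * sumFin² d g
sumFin³-const₃ d g =
  trans (sumFin-cong d (λ a →
           trans (sumFin-cong d (λ b → sumFin-const d (g a b))) (sumFin-*ˡ d d (g a))))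
        (sumFin-*ˡ d d _)

sumFin³-const₁ : ∀ d (g : Fin d → Fin d → ℕ) → sumFin³ d (λ _ b c → g b c) ≡ d * sumFin² d g
sumFin³-const₁ d g = sumFin-const d (sumFin² d g)

sumFin³-const₂ : ∀ d (g : Fin d → Fin d → ℕ) → sumFin³ d (λ a _ c → g c a) ≡ d * sumFin² d g
sumFin³-const₂ d g =
  trans (sumFin-cong d (λ a → sumFin-const d (sumFin d (λ c → g c a))))
        (trans (sumFin-*ˡ d d _) (cong (d *_) (sumFin-swap d d (λ a c → g c a))))

count : ∀ {d} → (Fin d → Fin d → Bool) → ℕ
count {d} R = sumFin² d (λ x y → 𝟙 (R x y))

𝟙x+𝟙y+𝟙z≤2+𝟙[x∧y∧z] : ∀ x y z → 𝟙 x + 𝟙 y + 𝟙 z ≤ 2 + 𝟙 (x ∧ y ∧ z)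
𝟙x+𝟙y+𝟙z≤2+𝟙[x∧y∧z] true  true  true  = ≤-refl
𝟙x+𝟙y+𝟙z≤2+𝟙[x∧y∧z] true  true  false = s≤s (s≤s z≤n)
𝟙x+𝟙y+𝟙z≤2+𝟙[x∧y∧z] true  false true  = s≤s (s≤s z≤n)
𝟙x+𝟙y+𝟙z≤2+𝟙[x∧y∧z] true  false false = s≤s z≤n
𝟙x+𝟙y+𝟙z≤2+𝟙[x∧y∧z] false true  true  = s≤s (s≤s z≤n)
𝟙x+𝟙y+𝟙z≤2+𝟙[x∧y∧z] false true  false = s≤s z≤n
𝟙x+𝟙y+𝟙z≤2+𝟙[x∧y∧z] false false true  = s≤s z≤n
𝟙x+𝟙y+𝟙z≤2+𝟙[x∧y∧z] false false false = z≤n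

𝟙[x∧y∧z]≤𝟙z : ∀ x y z → 𝟙 (x ∧ y ∧ z) ≤ 𝟙 z
𝟙[x∧y∧z]≤𝟙z true  true  z = ≤-refl
𝟙[x∧y∧z]≤𝟙z true  false z = z≤n
𝟙[x∧y∧z]≤𝟙z false y     z = z≤n

module _ {d : ℕ} (W : EdgeSet d) where

  edgeIndicators : Fin d → Fin d → Fin d → ℕ
  edgeIndicators a b c = 𝟙 (AB W a b) + 𝟙 (BC W b c) + 𝟙 (CA W c a)

  sumFin³-edgeIndicators : sumFin³ d edgeIndicators ≡ d * edgeCount W
  sumFin³-edgeIndicators = begin
    sumFin³ d edgeIndicators
      ≡⟨ trans (sumFin³-+ d _ _) (cong (_+ sumFin³ d (λ a _ c → 𝟙 (CA W c a))) (sumFin³-+ d _ _)) ⟩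
    sumFin³ d (λ a b _ → 𝟙 (AB W a b)) + sumFin³ d (λ _ b c → 𝟙 (BC W b c))
      + sumFin³ d (λ a _ c → 𝟙 (CA W c a))
      ≡⟨ cong₂ _+_ (cong₂ _+_ (sumFin³-const₃ d _) (sumFin³-const₁ d _)) (sumFin³-const₂ d _) ⟩
    d * count (AB W) + d * count (BC W) + d * count (CA W)
      ≡⟨ sym (trans (*-distribˡ-+ d _ _) (cong (_+ d * count (CA W)) (*-distribˡ-+ d _ _))) ⟩
    d * edgeCount W ∎
    where open ≡-Reasoning

  d*edgeCount≤d*2d²+triangleCount : d * edgeCount W ≤ d * (2 * (d * d)) + triangleCount W
  d*edgeCount≤d*2d²+triangleCount = begin
    d * edgeCount W
      ≡⟨ sym sumFin³-edgeIndicators ⟩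
    sumFin³ d edgeIndicators
      ≤⟨ sumFin³-mono-≤ d (λ a b c → 𝟙x+𝟙y+𝟙z≤2+𝟙[x∧y∧z] (AB W a b) (BC W b c) (CA W c a)) ⟩
    sumFin³ d (λ a b c → 2 + 𝟙 (AB W a b ∧ BC W b c ∧ CA W c a))
      ≡⟨ sumFin³-+ d _ _ ⟩
    sumFin³ d (λ _ _ _ → 2) + triangleCount W
      ≡⟨ cong (_+ triangleCount W) sumFin³-two ⟩
    d * (2 * (d * d)) + triangleCount W ∎
    where
    open ≤-Reasoning
    sumFin³-two : sumFin³ d (λ _ _ _ → 2) ≡ d * (2 * (d * d))
    sumFin³-two = begin-equality
      sumFin³ d (λ _ _ _ → 2)
        ≡⟨ trans (sumFin³-const₃ d _) (cong (d *_) (sumFin-const d (sumFin d (λ _ → 2)))) ⟩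
      d * (d * sumFin d (λ _ → 2))
        ≡⟨ cong (λ t → d * (d * t)) (sumFin-const d 2) ⟩
      d * (d * (d * 2))
        ≡⟨ cong (d *_) (trans (sym (*-assoc d d 2)) (*-comm (d * d) 2)) ⟩
      d * (2 * (d * d)) ∎

  triangleCount-lowerBound : d * (edgeCount W ∸ 2 * (d * d)) ≤ triangleCount W
  triangleCount-lowerBound = begin
    d * (edgeCount W ∸ 2 * (d * d))     ≡⟨ *-distribˡ-∸ d (edgeCount W) _ ⟩
    d * edgeCount W ∸ d * (2 * (d * d)) ≤⟨ m≤n+o⇒m∸n≤o _ _ d*edgeCount≤d*2d²+triangleCount ⟩
    triangleCount W                     ∎
    where open ≤-Reasoning

  triangleCount≤d*count-CA : triangleCount W ≤ d * count (CA W)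
  triangleCount≤d*count-CA = begin
    triangleCount W
      ≤⟨ sumFin³-mono-≤ d (λ a b c → 𝟙[x∧y∧z]≤𝟙z (AB W a b) (BC W b c) (CA W c a)) ⟩
    sumFin³ d (λ a _ c → 𝟙 (CA W c a))
      ≡⟨ sumFin³-const₂ d _ ⟩
    d * count (CA W) ∎
    where open ≤-Reasoning

m⊓n+[m∸n]⊓o≡m⊓[n+o] : ∀ m n o → m ⊓ n + (m ∸ n) ⊓ o ≡ m ⊓ (n + o)
m⊓n+[m∸n]⊓o≡m⊓[n+o] zero    zero    o = refl
m⊓n+[m∸n]⊓o≡m⊓[n+o] zero    (suc n) o = refl
m⊓n+[m∸n]⊓o≡m⊓[n+o] (suc m) zero    o = refl
m⊓n+[m∸n]⊓o≡m⊓[n+o] (suc m) (suc n) o = cong suc (m⊓n+[m∸n]⊓o≡m⊓[n+o] m n o)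

m+n<ᵇo≡n<ᵇo∸m : ∀ m n o → (m + n <ᵇ o) ≡ (n <ᵇ o ∸ m)
m+n<ᵇo≡n<ᵇo∸m zero    n o       = refl
m+n<ᵇo≡n<ᵇo∸m (suc m) n zero    = refl
m+n<ᵇo≡n<ᵇo∸m (suc m) n (suc o) = m+n<ᵇo≡n<ᵇo∸m m n o

sumFin-𝟙[j<ᵇk] : ∀ n k → sumFin n (λ j → 𝟙 (toℕ j <ᵇ k)) ≡ k ⊓ n
sumFin-𝟙[j<ᵇk] zero    k       = sym (⊓-zeroʳ k)
sumFin-𝟙[j<ᵇk] (suc n) zero    = sumFin-𝟙[j<ᵇk] n zero   -- x <ᵇ 0 reduces to false for any x
sumFin-𝟙[j<ᵇk] (suc n) (suc k) = cong suc (sumFin-𝟙[j<ᵇk] n k)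

sumFin²-𝟙[i*n+j<ᵇk] : ∀ m n k →
  sumFin m (λ i → sumFin n (λ j → 𝟙 (toℕ i * n + toℕ j <ᵇ k))) ≡ k ⊓ (m * n)
sumFin²-𝟙[i*n+j<ᵇk] zero    n k = sym (⊓-zeroʳ k)
sumFin²-𝟙[i*n+j<ᵇk] (suc m) n k = begin
  sumFin n (λ j → 𝟙 (toℕ j <ᵇ k))
    + sumFin m (λ i → sumFin n (λ j → 𝟙 (n + toℕ i * n + toℕ j <ᵇ k)))
      ≡⟨ cong (_ +_) (sumFin-cong m (λ i → sumFin-cong n (λ j → cong 𝟙 (shift i j)))) ⟩
  sumFin n (λ j → 𝟙 (toℕ j <ᵇ k))
    + sumFin m (λ i → sumFin n (λ j → 𝟙 (toℕ i * n + toℕ j <ᵇ k ∸ n)))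
      ≡⟨ cong₂ _+_ (sumFin-𝟙[j<ᵇk] n k) (sumFin²-𝟙[i*n+j<ᵇk] m n (k ∸ n)) ⟩
  k ⊓ n + (k ∸ n) ⊓ (m * n)
      ≡⟨ m⊓n+[m∸n]⊓o≡m⊓[n+o] k n (m * n) ⟩
  k ⊓ (n + m * n) ∎
  where
  open ≡-Reasoning
  shift : ∀ i j → (n + toℕ i * n + toℕ j <ᵇ k) ≡ (toℕ i * n + toℕ j <ᵇ k ∸ n)
  shift i j = trans (cong (_<ᵇ k) (+-assoc n _ _)) (m+n<ᵇo≡n<ᵇo∸m n _ k)

firstCells : ∀ d → ℕ → Fin d → Fin d → Bool
firstCells d k i j = toℕ i * d + toℕ j <ᵇ k

count-firstCells : ∀ d k → count (firstCells d k) ≡ k ⊓ (d * d)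
count-firstCells d k = sumFin²-𝟙[i*n+j<ᵇk] d d k

firstEdges : ∀ d → ℕ → EdgeSet d
firstEdges d w = record
  { AB = firstCells d w
  ; BC = firstCells d (w ∸ d * d)
  ; CA = firstCells d (w ∸ 2 * (d * d))
  }

edgeCount-firstEdges : ∀ d w → w ≤ 3 * (d * d) → edgeCount (firstEdges d w) ≡ w
edgeCount-firstEdges d w w≤3n = begin
  count (firstCells d w) + count (firstCells d (w ∸ n)) + count (firstCells d (w ∸ 2 * n))
    ≡⟨ cong₂ _+_ (cong₂ _+_ (count-firstCells d w) (count-firstCells d (w ∸ n)))
                 (count-firstCells d (w ∸ 2 * n)) ⟩
  w ⊓ n + (w ∸ n) ⊓ n + (w ∸ 2 * n) ⊓ n
    ≡⟨ cong (_+ (w ∸ 2 * n) ⊓ n) (m⊓n+[m∸n]⊓o≡m⊓[n+o] w n n) ⟩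
  w ⊓ (n + n) + (w ∸ 2 * n) ⊓ n
    ≡⟨ cong (λ t → w ⊓ t + (w ∸ 2 * n) ⊓ n) n+n≡2*n ⟩
  w ⊓ (2 * n) + (w ∸ 2 * n) ⊓ n
    ≡⟨ m⊓n+[m∸n]⊓o≡m⊓[n+o] w (2 * n) n ⟩
  w ⊓ (2 * n + n)
    ≡⟨ cong (w ⊓_) (+-comm (2 * n) n) ⟩
  w ⊓ (3 * n)
    ≡⟨ m≤n⇒m⊓n≡m w≤3n ⟩
  w ∎
  where
  open ≡-Reasoning
  n = d * d
  n+n≡2*n : n + n ≡ 2 * n
  n+n≡2*n = cong (n +_) (sym (+-identityʳ n))

triangleCount-firstEdges : ∀ d w → w ≤ 3 * (d * d) →
  triangleCount (firstEdges d w) ≡ d * (w ∸ 2 * (d * d))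
triangleCount-firstEdges d w w≤3n = ≤-antisym upper lower
  where
  open ≤-Reasoning
  lower : d * (w ∸ 2 * (d * d)) ≤ triangleCount (firstEdges d w)
  lower = subst (λ e → d * (e ∸ 2 * (d * d)) ≤ triangleCount (firstEdges d w))
                (edgeCount-firstEdges d w w≤3n) (triangleCount-lowerBound (firstEdges d w))
  upper : triangleCount (firstEdges d w) ≤ d * (w ∸ 2 * (d * d))
  upper = begin
    triangleCount (firstEdges d w)        ≤⟨ triangleCount≤d*count-CA (firstEdges d w) ⟩
    d * count (firstCells d (w ∸ 2 * (d * d)))
      ≡⟨ cong (d *_) (count-firstCells d (w ∸ 2 * (d * d))) ⟩
    d * ((w ∸ 2 * (d * d)) ⊓ (d * d))    ≤⟨ *-monoʳ-≤ d (m⊓n≤m _ _) ⟩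
    d * (w ∸ 2 * (d * d))                 ∎

claim5p1 : (d : ℕ) → 1 ≤ d →
    ((W : EdgeSet d) → d * (edgeCount W ∸ 2 * (d * d)) ≤ triangleCount W)
    × ((w : ℕ) → w ≤ 3 * (d * d) →
        Σ[ W ∈ EdgeSet d ] (edgeCount W ≡ w × triangleCount W ≡ d * (w ∸ 2 * (d * d))))
claim5p1 d _ =   -- the argument needs no assumption on d
  triangleCount-lowerBound ,
  λ w w≤3d² → firstEdges d w , edgeCount-firstEdges d w w≤3d² , triangleCount-firstEdges d w w≤3d²
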